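{- Every sentence $\varphi$ of $\mathbf{FO}(\mathrm{NE}, \sqcup)$ is logically equivalent to some first-order sentence $\varphi'$, i.e. for every structure $\mathfrak M$, $\mathfrak M \models_{\{\emptyset\}} \varphi$ iff $\mathfrak M \models \varphi'$ in Tarski semantics.
   Context: Team semantics (lax version). Let $\mathfrak M$ be a first-order structure with domain $M$. A team $X$ with domain $V$ is a set of assignments $s: V \to M$. First-order parts of formulas are in negation normal form. Satisfaction $\mathfrak M \models_X \varphi$: for a first-order literal $\alpha$, iff every $s \in X$ satisfies $\alpha$ in Tarski semantics; $\psi \vee \theta$ iff $X = Y \cup Z$ with $\mathfrak M \models_Y \psi$, $\mathfrak M \models_Z \theta$; $\psi\wedge\theta$ iff both; $\exists v \psi$ iff there is $F : X \to \mathcal P(M)\setminus\{\emptyset\}$ with $\mathfrak M \models_{X[F/v]} \psi$, $X[F/v] = \{s[m/v] : s \in X, m \in F(s)\}$; $\forall v \psi$ iff $\mathfrak M \models_{X[M/v]} \psi$, $X[M/v] = \{s[m/v]: s \in X, m \in M\}$. Moreover $\mathfrak M \models_X \varphi \sqcup \psi$ iff $\mathfrak M \models_X \varphi$ or $\mathfrak M \models_X \psi$, and $\mathfrak M \models_X \mathrm{NE}$ iff $X \neq \emptyset$. $\mathbf{FO}(\mathrm{NE},\sqcup)$ is first-order logic extended with $\mathrm{NE}$ and $\sqcup$. A sentence $\varphi$ is true in $\mathfrak M$ iff $\mathfrak M \models_{\{\emptyset\}} \varphi$, where $\{\emptyset\}$ is the team containing only the empty assignment. -}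

module Defs where

open import Data.Nat using (ℕ; suc)
open import Data.Fin using (Fin)
open import Data.Vec using (Vec; []; _∷_; lookup)
open import Data.Product using (Σ; ∃; _×_; _,_)
open import Data.Sum using (_⊎_)
open import Data.Unit using (⊤)
open import Relation.Nullary using (¬_)
open import Relation.Binary.PropositionalEquality using (_≡_)
open import Level using (Level; 0ℓ) renaming (suc to lsuc)

record Signature : Set₁ where
  field
    FunSym   : Set
    funArity : FunSym → ℕ
    RelSym   : Set
    relArity : RelSym → ℕ
open Signature public

-- A first-order structure; the domain is nonempty (standard convention).
record Structure (σ : Signature) : Set₁ where
  field
    Carrier  : Set
    element  : Carrier
    funInterp : (f : FunSym σ) → Vec Carrier (funArity σ f) → Carrier
    relInterp : (R : RelSym σ) → Vec Carrier (relArity σ R) → Set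
open Structure public

data Term (σ : Signature) (n : ℕ) : Set where
  var : Fin n → Term σ n
  app : (f : FunSym σ) → Vec (Term σ n) (funArity σ f) → Term σ n

module _ {σ : Signature} (𝔐 : Structure σ) where
  mutual
    evalTerm : ∀ {n} → Vec (Carrier 𝔐) n → Term σ n → Carrier 𝔐
    evalTerm s (var i)    = lookup s i
    evalTerm s (app f ts) = funInterp 𝔐 f (evalTerms s ts)

    evalTerms : ∀ {n k} → Vec (Carrier 𝔐) n → Vec (Term σ n) k → Vec (Carrier 𝔐) k
    evalTerms s []       = []
    evalTerms s (t ∷ ts) = evalTerm s t ∷ evalTerms s ts

data Literal (σ : Signature) (n : ℕ) : Set where
  rel    : (R : RelSym σ) → Vec (Term σ n) (relArity σ R) → Literal σ n
  nrel   : (R : RelSym σ) → Vec (Term σ n) (relArity σ R) → Literal σ n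
  eq     : Term σ n → Term σ n → Literal σ n
  neq    : Term σ n → Term σ n → Literal σ n

data FOFormula (σ : Signature) : ℕ → Set where
  lit  : ∀ {n} → Literal σ n → FOFormula σ n
  _∧_  : ∀ {n} → FOFormula σ n → FOFormula σ n → FOFormula σ n
  _∨_  : ∀ {n} → FOFormula σ n → FOFormula σ n → FOFormula σ n
  ∃'   : ∀ {n} → FOFormula σ (suc n) → FOFormula σ n   -- binds variable 0
  ∀'   : ∀ {n} → FOFormula σ (suc n) → FOFormula σ n

FOSentence : Signature → Set
FOSentence σ = FOFormula σ 0

module _ {σ : Signature} (𝔐 : Structure σ) where
  private M = Carrier 𝔐

  litSat : ∀ {n} → Vec M n → Literal σ n → Set
  litSat s (rel R ts)  = relInterp 𝔐 R (evalTerms 𝔐 s ts)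
  litSat s (nrel R ts) = ¬ relInterp 𝔐 R (evalTerms 𝔐 s ts)
  litSat s (eq t u)    = evalTerm 𝔐 s t ≡ evalTerm 𝔐 s u
  litSat s (neq t u)   = ¬ (evalTerm 𝔐 s t ≡ evalTerm 𝔐 s u)

  tarski : ∀ {n} → Vec M n → FOFormula σ n → Set
  tarski s (lit α)  = litSat s α
  tarski s (φ ∧ ψ)  = tarski s φ × tarski s ψ
  tarski s (φ ∨ ψ)  = tarski s φ ⊎ tarski s ψ
  tarski s (∃' φ)   = Σ M λ m → tarski (m ∷ s) φ
  tarski s (∀' φ)   = (m : M) → tarski (m ∷ s) φ

  _⊨FO_ : FOSentence σ → Set
  _⊨FO_ φ = tarski [] φ

data TFormula (σ : Signature) : ℕ → Set where
  lit  : ∀ {n} → Literal σ n → TFormula σ n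
  NE   : ∀ {n} → TFormula σ n
  _∧_  : ∀ {n} → TFormula σ n → TFormula σ n → TFormula σ n
  _∨_  : ∀ {n} → TFormula σ n → TFormula σ n → TFormula σ n
  _⊔_  : ∀ {n} → TFormula σ n → TFormula σ n → TFormula σ n
  ∃'   : ∀ {n} → TFormula σ (suc n) → TFormula σ n
  ∀'   : ∀ {n} → TFormula σ (suc n) → TFormula σ n

TSentence : Signature → Set
TSentence σ = TFormula σ 0

module _ {σ : Signature} (𝔐 : Structure σ) where
  private M = Carrier 𝔐

  Team : ℕ → Set₁
  Team n = Vec M n → Set

  -- X[F/v] for F : X → P(M) ∖ {∅}  (the new variable is index 0)
  supplement : ∀ {n} → Team n → (Vec M n → M → Set) → Team (suc n)
  supplement X F (m ∷ s) = X s × F s m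

  duplicate : ∀ {n} → Team n → Team (suc n)
  duplicate X (m ∷ s) = X s

  teamSat : ∀ {n} → Team n → TFormula σ n → Set₁
  teamSat X (lit α) = Level.Lift _ (∀ s → X s → litSat 𝔐 s α)
  teamSat X NE      = Level.Lift _ (Σ (Vec M _) X)
  teamSat X (φ ∧ ψ) = teamSat X φ × teamSat X ψ
  teamSat X (φ ∨ ψ) =
    Σ (Team _) λ Y → Σ (Team _) λ Z →
      ((∀ s → X s → Y s ⊎ Z s) × (∀ s → Y s ⊎ Z s → X s))
      × teamSat Y φ × teamSat Z ψ
  teamSat X (φ ⊔ ψ) = teamSat X φ ⊎ teamSat X ψ
  teamSat X (∃' φ)  =
    Σ (Vec M _ → M → Set) λ F →
      (∀ s → X s → Σ M (F s)) × teamSat (supplement X F) φ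
  teamSat X (∀' φ)  = teamSat (duplicate X) φ

  emptyAssignmentTeam : Team 0
  emptyAssignmentTeam [] = ⊤

  _⊨T_ : TSentence σ → Set₁
  _⊨T_ φ = teamSat emptyAssignmentTeam φ

module Submission where

-- Proof idea: a normal form.  Call a pair  α ▷ [β₁, …, βₖ]  of first-order
-- formulas a *clause*; a team X satisfies it when every assignment of X
-- satisfies α and each βᵢ is satisfied by at least one assignment of X
-- (in FO(NE) this is  α ∧ ⋀ᵢ (⊤ ∨ (βᵢ ∧ NE))).  We show that every
-- formula φ of FO(NE, ⊔) is equivalent, on every team, to a finite
-- ⊔-disjunction of clauses  normalForm φ : the connectives ∧, ∨, ∃, ∀
-- each have a clause-level counterpart (∧ᶜ, ∨ᶜ, ∃ᶜ, ∀ᶜ) which is sound and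
-- complete for team semantics, and ⊔ is concatenation of the lists.
-- On the team {∅} a clause  α ▷ βs  holds iff the sentence  α ∧ ⋀ βs  is
-- true in Tarski semantics, so the ⊔-disjunction becomes an ordinary
-- disjunction and yields the required first-order sentence.

open import Defs
open import Data.Product using (Σ; ∃; _×_; _,_; proj₁; proj₂)
open import Function.Bundles using (_⇔_; mk⇔; Equivalence)
open import Level using (Lift; suc; zero; lift; lower)
open import Data.Nat using (ℕ) renaming (suc to 1+)
open import Data.Fin using () renaming (zero to fzero)
open import Data.Vec using (Vec; []; _∷_)
open import Data.List using (List; []; _∷_; [_]; _++_; map; cartesianProductWith)
open import Data.List.Relation.Unary.All as All using (All; []; _∷_)
open import Data.List.Relation.Unary.All.Properties as All using ()
open import Data.List.Relation.Unary.Any using (Any; here; there)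
open import Data.List.Relation.Unary.Any.Properties as Any using ()
open import Data.List.Membership.Propositional using (_∈_; find; lose)
open import Data.List.Membership.Propositional.Properties
  using (∈-++⁺ˡ; ∈-++⁺ʳ; ∈-++⁻; ∈-map⁺; ∈-map⁻; ∈-cartesianProductWith⁺; ∈-cartesianProductWith⁻)
open import Data.Sum using (_⊎_; inj₁; inj₂)
open import Data.Unit using (tt)
open import Relation.Binary.PropositionalEquality using (refl)

⊤F : ∀ {σ n} → FOFormula σ n
⊤F = ∀' (lit (eq (var fzero) (var fzero)))

⊥F : ∀ {σ n} → FOFormula σ n
⊥F = ∃' (lit (neq (var fzero) (var fzero)))

⋀ : ∀ {σ n} → List (FOFormula σ n) → FOFormula σ n
⋀ []       = ⊤F
⋀ (β ∷ βs) = β ∧ ⋀ βs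

⋁ : ∀ {σ n} → List (FOFormula σ n) → FOFormula σ n
⋁ []       = ⊥F
⋁ (β ∷ βs) = β ∨ ⋁ βs

module _ {σ : Signature} (𝔐 : Structure σ) {n : ℕ} (s : Vec (Carrier 𝔐) n) where

  ⋀-tarski : ∀ βs → tarski 𝔐 s (⋀ βs) ⇔ All (tarski 𝔐 s) βs
  ⋀-tarski βs = mk⇔ (to βs) (from βs)
    where
    to : ∀ βs → tarski 𝔐 s (⋀ βs) → All (tarski 𝔐 s) βs
    to []       _         = []
    to (β ∷ βs) (b , bs)  = b ∷ to βs bs
    from : ∀ βs → All (tarski 𝔐 s) βs → tarski 𝔐 s (⋀ βs)
    from []       []        = λ _ → refl
    from (β ∷ βs) (b ∷ bs)  = b , from βs bs

  ⋁-tarski : ∀ βs → tarski 𝔐 s (⋁ βs) ⇔ Any (tarski 𝔐 s) βs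
  ⋁-tarski βs = mk⇔ (to βs) (from βs)
    where
    to : ∀ βs → tarski 𝔐 s (⋁ βs) → Any (tarski 𝔐 s) βs
    to []       (_ , x≢x) with () ← x≢x refl
    to (β ∷ βs) (inj₁ b)  = here b
    to (β ∷ βs) (inj₂ bs) = there (to βs bs)
    from : ∀ βs → Any (tarski 𝔐 s) βs → tarski 𝔐 s (⋁ βs)
    from (β ∷ βs) (here b)   = inj₁ b
    from (β ∷ βs) (there bs) = inj₂ (from βs bs)

-- A clause  α ▷ βs : α must hold throughout the team, each β ∈ βs somewhere in it.
record Clause (σ : Signature) (n : ℕ) : Set where
  constructor _▷_
  field
    flat      : FOFormula σ n
    witnesses : List (FOFormula σ n)

module _ {σ : Signature} {n : ℕ} where

  _∧ᶜ_ : Clause σ n → Clause σ n → Clause σ n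
  (α ▷ βs) ∧ᶜ (α' ▷ βs') = (α ∧ α') ▷ (βs ++ βs')

  -- Split disjunction: a witness of one half of the split also satisfies
  -- that half's flat part, and that is all one can say about it in X.
  _∨ᶜ_ : Clause σ n → Clause σ n → Clause σ n
  (α ▷ βs) ∨ᶜ (α' ▷ βs') = (α ∨ α') ▷ (map (α ∧_) βs ++ map (α' ∧_) βs')

  -- Lax existential: every witness comes together with a value satisfying α.
  ∃ᶜ : Clause σ (1+ n) → Clause σ n
  ∃ᶜ (α ▷ βs) = ∃' α ▷ map (λ β → ∃' (α ∧ β)) βs

  -- Universal: the duplicated team has a witness of β iff some value does.
  ∀ᶜ : Clause σ (1+ n) → Clause σ n
  ∀ᶜ (α ▷ βs) = ∀' α ▷ map ∃' βs

normalForm : ∀ {σ n} → TFormula σ n → List (Clause σ n)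
normalForm (lit l) = [ lit l ▷ [] ]
normalForm NE      = [ ⊤F ▷ [ ⊤F ] ]
normalForm (φ ∧ ψ) = cartesianProductWith _∧ᶜ_ (normalForm φ) (normalForm ψ)
normalForm (φ ∨ ψ) = cartesianProductWith _∨ᶜ_ (normalForm φ) (normalForm ψ)
normalForm (φ ⊔ ψ) = normalForm φ ++ normalForm ψ
normalForm (∃' φ)  = map ∃ᶜ (normalForm φ)
normalForm (∀' φ)  = map ∀ᶜ (normalForm φ)

clauseSentence : ∀ {σ} → Clause σ 0 → FOSentence σ
clauseSentence (α ▷ βs) = α ∧ ⋀ βs

translation : ∀ {σ} → TSentence σ → FOSentence σ
translation φ = ⋁ (map clauseSentence (normalForm φ))

module ClauseSemantics {σ : Signature} (𝔐 : Structure σ) where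
  private
    M = Carrier 𝔐

  Witnessed : ∀ {n} → Team 𝔐 n → FOFormula σ n → Set
  Witnessed X β = ∃ λ s → X s × tarski 𝔐 s β

  infix 4 _⊩_ _⊩ⁿᶠ_

  _⊩_ : ∀ {n} → Team 𝔐 n → Clause σ n → Set
  X ⊩ (α ▷ βs) = (∀ s → X s → tarski 𝔐 s α) × All (Witnessed X) βs

  _⊩ⁿᶠ_ : ∀ {n} → Team 𝔐 n → List (Clause σ n) → Set
  X ⊩ⁿᶠ cs = ∃ λ c → c ∈ cs × X ⊩ c

  Covers : ∀ {n} → Team 𝔐 n → Team 𝔐 n → Team 𝔐 n → Set
  Covers X Y Z = (∀ s → X s → Y s ⊎ Z s) × (∀ s → Y s ⊎ Z s → X s)

  witnesses-map⁺ : ∀ {m n} {X : Team 𝔐 n} {Y : Team 𝔐 m} (f : FOFormula σ m → FOFormula σ n) {βs} →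
    (∀ β → Witnessed Y β → Witnessed X (f β)) → All (Witnessed Y) βs → All (Witnessed X) (map f βs)
  witnesses-map⁺ f g w = All.map⁺ (All.map (λ {β} → g β) w)

  witnesses-map⁻ : ∀ {m n} {X : Team 𝔐 n} {Y : Team 𝔐 m} (f : FOFormula σ m → FOFormula σ n) {βs} →
    (∀ β → Witnessed X (f β) → Witnessed Y β) → All (Witnessed X) (map f βs) → All (Witnessed Y) βs
  witnesses-map⁻ f g w = All.map (λ {β} → g β) (All.map⁻ w)

  module _ {n : ℕ} where

    ⊩-∧⁺ : ∀ {X : Team 𝔐 n} c d → X ⊩ c → X ⊩ d → X ⊩ c ∧ᶜ d
    ⊩-∧⁺ (α ▷ βs) (α' ▷ βs') (a , w) (a' , w') = (λ s x → a s x , a' s x) , All.++⁺ w w'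

    ⊩-∧⁻ : ∀ {X : Team 𝔐 n} c d → X ⊩ c ∧ᶜ d → X ⊩ c × X ⊩ d
    ⊩-∧⁻ (α ▷ βs) (α' ▷ βs') (a , w) with w₁ , w₂ ← All.++⁻ βs w =
      ((λ s x → proj₁ (a s x)) , w₁) , ((λ s x → proj₂ (a s x)) , w₂)

    ⊩-∨⁺ : ∀ {X Y Z : Team 𝔐 n} c d → Covers X Y Z → Y ⊩ c → Z ⊩ d → X ⊩ c ∨ᶜ d
    ⊩-∨⁺ {X} {Y} {Z} (α ▷ βs) (α' ▷ βs') (split , join) (a , w) (a' , w') =
      flatPart , All.++⁺ (witnesses-map⁺ (α ∧_) fromY w) (witnesses-map⁺ (α' ∧_) fromZ w')
      where
      flatPart : ∀ s → X s → tarski 𝔐 s (α ∨ α')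
      flatPart s x with split s x
      ... | inj₁ y = inj₁ (a s y)
      ... | inj₂ z = inj₂ (a' s z)
      fromY : ∀ β → Witnessed Y β → Witnessed X (α ∧ β)
      fromY _ (s , y , b) = s , join s (inj₁ y) , a s y , b
      fromZ : ∀ β → Witnessed Z β → Witnessed X (α' ∧ β)
      fromZ _ (s , z , b) = s , join s (inj₂ z) , a' s z , b

    -- The split is  Y = X ∩ ⟦α⟧,  Z = X ∩ ⟦α'⟧.
    ⊩-∨⁻ : ∀ {X : Team 𝔐 n} c d → X ⊩ c ∨ᶜ d →
      Σ (Team 𝔐 n) λ Y → Σ (Team 𝔐 n) λ Z → Covers X Y Z × Y ⊩ c × Z ⊩ d
    ⊩-∨⁻ {X} (α ▷ βs) (α' ▷ βs') (a , w) with w₁ , w₂ ← All.++⁻ (map (α ∧_) βs) w =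
      Y , Z , (split , join)
        , ((λ _ y → proj₂ y) , witnesses-map⁻ (α ∧_) toY w₁)
        , ((λ _ z → proj₂ z) , witnesses-map⁻ (α' ∧_) toZ w₂)
      where
      Y Z : Team 𝔐 n
      Y s = X s × tarski 𝔐 s α
      Z s = X s × tarski 𝔐 s α'
      split : ∀ s → X s → Y s ⊎ Z s
      split s x with a s x
      ... | inj₁ p = inj₁ (x , p)
      ... | inj₂ p = inj₂ (x , p)
      join : ∀ s → Y s ⊎ Z s → X s
      join s (inj₁ (x , _)) = x
      join s (inj₂ (x , _)) = x
      toY : ∀ β → Witnessed X (α ∧ β) → Witnessed Y β
      toY _ (s , x , p , b) = s , (x , p) , b
      toZ : ∀ β → Witnessed X (α' ∧ β) → Witnessed Z β
      toZ _ (s , x , p , b) = s , (x , p) , b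

    ⊩-∃⁺ : ∀ {X : Team 𝔐 n} {F : Vec M n → M → Set} c →
      (∀ s → X s → Σ M (F s)) → supplement 𝔐 X F ⊩ c → X ⊩ ∃ᶜ c
    ⊩-∃⁺ {X} {F} (α ▷ βs) choose (a , w) = flatPart , witnesses-map⁺ (λ β → ∃' (α ∧ β)) witness w
      where
      flatPart : ∀ s → X s → tarski 𝔐 s (∃' α)
      flatPart s x with m , f ← choose s x = m , a (m ∷ s) (x , f)
      witness : ∀ β → Witnessed (supplement 𝔐 X F) β → Witnessed X (∃' (α ∧ β))
      witness _ (m ∷ s , (x , f) , b) = s , x , m , a (m ∷ s) (x , f) , b

    -- The supplementing function picks all values satisfying α.
    ⊩-∃⁻ : ∀ {X : Team 𝔐 n} c → X ⊩ ∃ᶜ c →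
      Σ (Vec M n → M → Set) λ F → (∀ s → X s → Σ M (F s)) × supplement 𝔐 X F ⊩ c
    ⊩-∃⁻ {X} (α ▷ βs) (a , w) = F , a , flatPart , witnesses-map⁻ (λ β → ∃' (α ∧ β)) witness w
      where
      F : Vec M n → M → Set
      F s m = tarski 𝔐 (m ∷ s) α
      flatPart : ∀ s → supplement 𝔐 X F s → tarski 𝔐 s α
      flatPart (m ∷ s) (_ , p) = p
      witness : ∀ β → Witnessed X (∃' (α ∧ β)) → Witnessed (supplement 𝔐 X F) β
      witness _ (s , x , m , p , b) = m ∷ s , (x , p) , b

    ⊩-∀⁺ : ∀ {X : Team 𝔐 n} c → duplicate 𝔐 X ⊩ c → X ⊩ ∀ᶜ c
    ⊩-∀⁺ {X} (α ▷ βs) (a , w) = (λ s x m → a (m ∷ s) x) , witnesses-map⁺ ∃' witness w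
      where
      witness : ∀ β → Witnessed (duplicate 𝔐 X) β → Witnessed X (∃' β)
      witness _ (m ∷ s , x , b) = s , x , m , b

    ⊩-∀⁻ : ∀ {X : Team 𝔐 n} c → X ⊩ ∀ᶜ c → duplicate 𝔐 X ⊩ c
    ⊩-∀⁻ {X} (α ▷ βs) (a , w) = flatPart , witnesses-map⁻ ∃' witness w
      where
      flatPart : ∀ s → duplicate 𝔐 X s → tarski 𝔐 s α
      flatPart (m ∷ s) x = a s x m
      witness : ∀ β → Witnessed X (∃' β) → Witnessed (duplicate 𝔐 X) β
      witness _ (s , x , m , b) = m ∷ s , x , b

  normalForm-sound : ∀ {n} (φ : TFormula σ n) {X : Team 𝔐 n} → teamSat 𝔐 X φ → X ⊩ⁿᶠ normalForm φ
  normalForm-sound (lit l) (lift a)      = _ , here refl , a , []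
  normalForm-sound NE      (lift (s , x)) = _ , here refl , (λ _ _ _ → refl) , (s , x , λ _ → refl) ∷ []
  normalForm-sound (φ ∧ ψ) (t , u)
    with c , c∈ , Xc ← normalForm-sound φ t | d , d∈ , Xd ← normalForm-sound ψ u =
    c ∧ᶜ d , ∈-cartesianProductWith⁺ _∧ᶜ_ c∈ d∈ , ⊩-∧⁺ c d Xc Xd
  normalForm-sound (φ ∨ ψ) (Y , Z , cover , t , u)
    with c , c∈ , Yc ← normalForm-sound φ t | d , d∈ , Zd ← normalForm-sound ψ u =
    c ∨ᶜ d , ∈-cartesianProductWith⁺ _∨ᶜ_ c∈ d∈ , ⊩-∨⁺ c d cover Yc Zd
  normalForm-sound (φ ⊔ ψ) (inj₁ t) with c , c∈ , Xc ← normalForm-sound φ t =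
    c , ∈-++⁺ˡ c∈ , Xc
  normalForm-sound (φ ⊔ ψ) (inj₂ u) with c , c∈ , Xc ← normalForm-sound ψ u =
    c , ∈-++⁺ʳ (normalForm φ) c∈ , Xc
  normalForm-sound (∃' φ) (F , choose , t) with c , c∈ , Xc ← normalForm-sound φ t =
    ∃ᶜ c , ∈-map⁺ ∃ᶜ c∈ , ⊩-∃⁺ c choose Xc
  normalForm-sound (∀' φ) t with c , c∈ , Xc ← normalForm-sound φ t =
    ∀ᶜ c , ∈-map⁺ ∀ᶜ c∈ , ⊩-∀⁺ c Xc

  normalForm-complete : ∀ {n} (φ : TFormula σ n) {X : Team 𝔐 n} → X ⊩ⁿᶠ normalForm φ → teamSat 𝔐 X φ
  normalForm-complete (lit l) (_ , here refl , a , _)           = lift a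
  normalForm-complete NE      (_ , here refl , _ , (s , x , _) ∷ []) = lift (s , x)
  normalForm-complete (φ ∧ ψ) (_ , e∈ , Xe)
    with c , d , c∈ , d∈ , refl ← ∈-cartesianProductWith⁻ _∧ᶜ_ (normalForm φ) (normalForm ψ) e∈
    with Xc , Xd ← ⊩-∧⁻ c d Xe =
    normalForm-complete φ (c , c∈ , Xc) , normalForm-complete ψ (d , d∈ , Xd)
  normalForm-complete (φ ∨ ψ) (_ , e∈ , Xe)
    with c , d , c∈ , d∈ , refl ← ∈-cartesianProductWith⁻ _∨ᶜ_ (normalForm φ) (normalForm ψ) e∈
    with Y , Z , cover , Yc , Zd ← ⊩-∨⁻ c d Xe =
    Y , Z , cover , normalForm-complete φ (c , c∈ , Yc) , normalForm-complete ψ (d , d∈ , Zd)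
  normalForm-complete (φ ⊔ ψ) (c , c∈ , Xc) with ∈-++⁻ (normalForm φ) c∈
  ... | inj₁ c∈φ = inj₁ (normalForm-complete φ (c , c∈φ , Xc))
  ... | inj₂ c∈ψ = inj₂ (normalForm-complete ψ (c , c∈ψ , Xc))
  normalForm-complete (∃' φ) (_ , e∈ , Xe)
    with c , c∈ , refl ← ∈-map⁻ ∃ᶜ e∈
    with F , choose , Xc ← ⊩-∃⁻ c Xe =
    F , choose , normalForm-complete φ (c , c∈ , Xc)
  normalForm-complete (∀' φ) (_ , e∈ , Xe) with c , c∈ , refl ← ∈-map⁻ ∀ᶜ e∈ =
    normalForm-complete φ (c , c∈ , ⊩-∀⁻ c Xe)

  private
    X∅ : Team 𝔐 0
    X∅ = emptyAssignmentTeam 𝔐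

  -- On {∅}, "some assignment satisfies β" is just Tarski truth of β.
  ⊩-sentence : ∀ c → X∅ ⊩ c ⇔ tarski 𝔐 [] (clauseSentence c)
  ⊩-sentence (α ▷ βs) = mk⇔
    (λ (a , w) → a [] tt , from (⋀-tarski 𝔐 [] βs) (All.map (λ { ([] , _ , b) → b }) w))
    (λ (a , bs) → (λ { [] _ → a }) , All.map (λ b → [] , tt , b) (to (⋀-tarski 𝔐 [] βs) bs))
    where open Equivalence

  ⊩ⁿᶠ-sentence : ∀ cs → X∅ ⊩ⁿᶠ cs ⇔ tarski 𝔐 [] (⋁ (map clauseSentence cs))
  ⊩ⁿᶠ-sentence cs = mk⇔
    (λ (c , c∈ , h) → from (⋁-tarski 𝔐 [] _) (Any.map⁺ (lose c∈ (to (⊩-sentence c) h))))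
    (λ t → let c , c∈ , h = find (Any.map⁻ (to (⋁-tarski 𝔐 [] _) t))
           in c , c∈ , from (⊩-sentence c) h)
    where open Equivalence

mainTheorem2 : (σ : Signature) (φ : TSentence σ) →
    Σ (FOSentence σ) λ φ' →
      (𝔐 : Structure σ) → (_⊨T_ 𝔐 φ ⇔ Lift (suc zero) (_⊨FO_ 𝔐 φ'))
mainTheorem2 σ φ = translation φ , λ 𝔐 →
  let open ClauseSemantics 𝔐
      open Equivalence (⊩ⁿᶠ-sentence (normalForm φ))
  in mk⇔ (λ t → lift (to (normalForm-sound φ t)))
         (λ t → normalForm-complete φ (from (lower t)))
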